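{- Every vertex of a simple grid graph $G$ has a neighbor in $G$ directly to its left or directly to its right.
   Context: A simple grid graph is a subgraph $G$ of the infinite square lattice $\mathbb{Z}^2$ consisting of all the vertices and edges of $\mathbb{Z}^2$ that lie on or in the interior of a simple closed loop $\alpha$ in $\mathbb{Z}^2$. The left and right neighbors of $(x,y)$ are $(x-1,y)$ and $(x+1,y)$. -}

module Defs where

open import Data.Bool using (Bool; true; false; _∧_; not; if_then_else_)
open import Data.Nat as ℕ using (ℕ; _%_)
open import Data.Integer using (ℤ; +_; _+_; _-_; _≤ᵇ_; 1ℤ)
open import Data.Product using (_×_; _,_; proj₁; proj₂)
open import Data.Sum using (_⊎_)
open import Data.List using (List; []; _∷_; _++_; [_]; zip; length)
open import Data.List.Membership.Propositional using (_∈_)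
open import Data.List.Relation.Unary.All using (All)
open import Data.List.Relation.Unary.Unique.Propositional using (Unique)
open import Relation.Binary.PropositionalEquality using (_≡_)

Point : Set
Point = ℤ × ℤ

LatticeAdj : Point → Point → Set
LatticeAdj (x₁ , y₁) (x₂ , y₂) =
  (y₁ ≡ y₂ × (x₂ ≡ x₁ + 1ℤ ⊎ x₁ ≡ x₂ + 1ℤ)) ⊎
  (x₁ ≡ x₂ × (y₂ ≡ y₁ + 1ℤ ⊎ y₁ ≡ y₂ + 1ℤ))

loopEdges : List Point → List (Point × Point)
loopEdges []       = []
loopEdges (p ∷ ps) = zip (p ∷ ps) (ps ++ [ p ])

record SimpleLoop : Set where
  field
    verts    : List Point
    long     : 3 ℕ.≤ length verts
    distinct : Unique verts
    steps    : All (λ e → LatticeAdj (proj₁ e) (proj₂ e)) (loopEdges verts)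
open SimpleLoop public

_<ᵇ_ : ℤ → ℤ → Bool
a <ᵇ b = not (b ≤ᵇ a)

double : ℤ → ℤ
double a = a + a

-- Does the horizontal ray going right from the point (a/2 , b/2)
-- (given in doubled coordinates) cross the loop edge e?  Half-open rule on
-- vertical edges (the standard even–odd crossing rule).
crosses : ℤ × ℤ → Point × Point → Bool
crosses (a , b) ((x₁ , y₁) , (x₂ , y₂)) =
  (double x₁ ≤ᵇ double x₂) ∧ (double x₂ ≤ᵇ double x₁) ∧   -- vertical edge
  (a <ᵇ double x₁) ∧
  (((double y₁ ≤ᵇ b) ∧ (b <ᵇ double y₂)) ∨' ((double y₂ ≤ᵇ b) ∧ (b <ᵇ double y₁)))
  where
  _∨'_ : Bool → Bool → Bool
  true  ∨' _ = true
  false ∨' c = c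

crossCount : ℤ × ℤ → List (Point × Point) → ℕ
crossCount q []       = 0
crossCount q (e ∷ es) = if crosses q e then ℕ.suc (crossCount q es) else crossCount q es

-- A point not on α (given in doubled coordinates) lies in the interior of α
-- iff the ray crosses α an odd number of times.
InInteriorD : SimpleLoop → ℤ × ℤ → Set
InInteriorD α q = crossCount q (loopEdges (verts α)) % 2 ≡ 1

-- Vertices of the simple grid graph bounded by α: lattice points on α or
-- in its interior (a lattice point not in verts α is not on α).
GVertex : SimpleLoop → Point → Set
GVertex α v = v ∈ verts α ⊎ InInteriorD α (double (proj₁ v) , double (proj₂ v))

-- Edges of the simple grid graph: lattice edges {u,w} lying on α (edges of
-- the loop) or in its interior (checked at the midpoint (u+w)/2; a lattice
-- edge that is not a loop edge has its midpoint off α).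
GEdge : SimpleLoop → Point → Point → Set
GEdge α u w =
  LatticeAdj u w ×
  ((u , w) ∈ loopEdges (verts α) ⊎ (w , u) ∈ loopEdges (verts α) ⊎
   InInteriorD α (proj₁ u + proj₁ w , proj₂ u + proj₂ w))

leftOf rightOf : Point → Point
leftOf  (x , y) = (x - 1ℤ , y)
rightOf (x , y) = (x + 1ℤ , y)

-- If v = (x , y) is interior,
-- the ray from the midpoint (x + 1/2 , y) meets the same loop edges as the ray
-- from v: the test compares the start 2x resp. 2x + 1 with twice the column of a
-- vertical edge, and 2x and 2x + 1 compare alike with every even number.  So the
-- edge to the right of v is interior.  If v is on α, the simple loop enters
-- and leaves v exactly once; a horizontal step is a loop edge of G.  Otherwise α
-- passes vertically through v, and the rays from (x ∓ 1/2 , y) see the same loop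
-- edges except the one joining v to the vertex above it, which (by the half-open
-- rule) only the left ray crosses.  The two crossing numbers differ by one, so one
-- of the midpoints is interior.
module Submission where

open import Defs
open import Data.Sum using (_⊎_)

open import Data.Bool using (true; false; _∧_; not; T?)
open import Data.Bool.Properties using (T-≡; ∧-zeroʳ; ∧-identityʳ)
open import Data.Nat as ℕ using (suc; _%_)
open import Data.Integer using (ℤ; _+_; _-_; _≤ᵇ_; 1ℤ; -1ℤ; _≤_; _<_; _≤?_; _≟_)
open import Data.Integer.Properties
open import Data.Product using (_×_; _,_; proj₁; proj₂)
open import Data.Sum using (inj₁; inj₂; swap)
open import Data.List using (List; []; _∷_; _++_; [_]; _∷ʳ_; length; zip; filter; initLast; _∷ʳ′_)
open import Data.List.Properties using (++-assoc; ++-identityʳ)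
open import Data.List.Membership.Propositional using (_∈_)
open import Data.List.Membership.Propositional.Properties using (∈-∃++; ∈-++⁺ʳ)
open import Data.List.Relation.Unary.Any using (here; there)
open import Data.List.Relation.Unary.All as All using (All; []; _∷_)
open import Data.List.Relation.Unary.All.Properties using (All¬⇒¬Any)
open import Data.List.Relation.Unary.AllPairs using (_∷_)
open import Data.List.Relation.Unary.Unique.Propositional using (Unique)
open import Data.List.Relation.Binary.Permutation.Propositional
  using (_↭_; ↭-refl; ↭-prep; ↭-swap; ↭-reflexive; ↭-trans; ↭-sym; ↭⇒↭ₛ)
  renaming (module PermutationReasoning to ↭-Reasoning)
open import Data.List.Relation.Binary.Permutation.Propositional.Properties
  using (∈-resp-↭; All-resp-↭; ↭-length; ++-comm; ∷↭∷ʳ; filter-↭)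
open import Data.List.Relation.Binary.Permutation.Setoid.Properties using (Unique-resp-↭)
open import Function using (_∘_; _⇔_; mk⇔; Equivalence)
open import Relation.Nullary using (yes; no; contradiction)
open import Relation.Binary using (tri<; tri≈; tri>)
open import Relation.Binary.PropositionalEquality hiding ([_])
open import Relation.Binary.PropositionalEquality.Properties using (setoid)

open Equivalence using (to; from)

≤ᵇ-true : ∀ {i j} → i ≤ j → (i ≤ᵇ j) ≡ true
≤ᵇ-true = to T-≡ ∘ ≤⇒≤ᵇ

≤ᵇ-false : ∀ {i j} → j < i → (i ≤ᵇ j) ≡ false
≤ᵇ-false {i} {j} j<i with i ≤ᵇ j in eq
... | false = refl
... | true  = contradiction (≤ᵇ⇒≤ (from T-≡ eq)) (<⇒≱ j<i)

≤ᵇ-cong : ∀ {i j k l} → i ≤ j ⇔ k ≤ l → (i ≤ᵇ j) ≡ (k ≤ᵇ l)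
≤ᵇ-cong {i} {j} i≤j⇔k≤l with i ≤? j
... | yes i≤j = trans (≤ᵇ-true i≤j) (sym (≤ᵇ-true (to i≤j⇔k≤l i≤j)))
... | no  i≰j = trans (≤ᵇ-false (≰⇒> i≰j)) (sym (≤ᵇ-false (≰⇒> (i≰j ∘ from i≤j⇔k≤l))))

i<i+1 : ∀ i → i < i + 1ℤ
i<i+1 i = suc[i]≤j⇒i<j (≤-reflexive (+-comm 1ℤ i))

i-1<i : ∀ i → i - 1ℤ < i
i-1<i i = i≤pred[j]⇒i<j (≤-reflexive (+-comm i -1ℤ))

i<j⇒i+1≤j : ∀ {i j} → i < j → i + 1ℤ ≤ j
i<j⇒i+1≤j {i} i<j = subst (_≤ _) (+-comm 1ℤ i) (i<j⇒suc[i]≤j i<j)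

i<j⇒i≤j-1 : ∀ {i j} → i < j → i ≤ j - 1ℤ
i<j⇒i≤j-1 {j = j} i<j = subst (_ ≤_) (+-comm -1ℤ j) (i<j⇒i≤pred[j] i<j)

i-1+1≡i : ∀ i → i - 1ℤ + 1ℤ ≡ i
i-1+1≡i i = trans (+-assoc i -1ℤ 1ℤ) (+-identityʳ i)

i≡j+1⇒i-1≡j : ∀ {i j} → i ≡ j + 1ℤ → i - 1ℤ ≡ j
i≡j+1⇒i-1≡j {j = j} refl = trans (+-assoc j 1ℤ -1ℤ) (+-identityʳ j)

double-mono-≤ : ∀ {i j} → i ≤ j → double i ≤ double j
double-mono-≤ i≤j = +-mono-≤ i≤j i≤j

double-mono-< : ∀ {i j} → i < j → double i < double j
double-mono-< i<j = +-mono-< i<j i<j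

double≤double+1 : ∀ i → double i ≤ i + (i + 1ℤ)
double≤double+1 i = +-monoʳ-≤ i (<⇒≤ (i<i+1 i))

double-≤-double+1⇒≤ : ∀ {i j} → double i ≤ j + (j + 1ℤ) → i ≤ j
double-≤-double+1⇒≤ 2i≤2j+1 = ≮⇒≥ λ j<i → <⇒≱ (+-mono-<-≤ j<i (i<j⇒i+1≤j j<i)) 2i≤2j+1

upOf downOf : Point → Point
upOf   (x , y) = (x , y + 1ℤ)
downOf (x , y) = (x , y - 1ℤ)

data Neighbour (v : Point) : Point → Set where
  left  : Neighbour v (leftOf v)
  right : Neighbour v (rightOf v)
  up    : Neighbour v (upOf v)
  down  : Neighbour v (downOf v)

neighbour : ∀ {v w} → LatticeAdj v w → Neighbour v w
neighbour {x , y} {_ , _} (inj₁ (refl , inj₁ refl)) = right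
neighbour {x , y} {_ , _} (inj₁ (refl , inj₂ x≡x′+1)) =
  subst (Neighbour (x , y)) (cong (_, y) (i≡j+1⇒i-1≡j x≡x′+1)) left
neighbour {x , y} {_ , _} (inj₂ (refl , inj₁ refl)) = up
neighbour {x , y} {_ , _} (inj₂ (refl , inj₂ y≡y′+1)) =
  subst (Neighbour (x , y)) (cong (x ,_) (i≡j+1⇒i-1≡j y≡y′+1)) down

adjacent-left : ∀ v → LatticeAdj v (leftOf v)
adjacent-left (x , y) = inj₁ (refl , inj₂ (sym (i-1+1≡i x)))

adjacent-right : ∀ v → LatticeAdj v (rightOf v)
adjacent-right (x , y) = inj₁ (refl , inj₁ refl)

LatticeAdj-sym : ∀ {p q} → LatticeAdj p q → LatticeAdj q p
LatticeAdj-sym {_ , _} {_ , _} (inj₁ (y≡y′ , adj)) = inj₁ (sym y≡y′ , swap adj)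
LatticeAdj-sym {_ , _} {_ , _} (inj₂ (x≡x′ , adj)) = inj₂ (sym x≡x′ , swap adj)

pathEdges : ∀ {A : Set} → List A → List (A × A)
pathEdges []           = []
pathEdges (a ∷ [])     = []
pathEdges (a ∷ b ∷ as) = (a , b) ∷ pathEdges (b ∷ as)

zip≡pathEdges : ∀ {A : Set} (a : A) as z → zip (a ∷ as) (as ∷ʳ z) ≡ pathEdges (a ∷ as ∷ʳ z)
zip≡pathEdges a []       z = refl
zip≡pathEdges a (b ∷ as) z = cong ((a , b) ∷_) (zip≡pathEdges b as z)

pathEdges-++ : ∀ {A : Set} (as : List A) m bs →
  pathEdges (as ++ m ∷ bs) ≡ pathEdges (as ∷ʳ m) ++ pathEdges (m ∷ bs)
pathEdges-++ []           m bs = refl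
pathEdges-++ (a ∷ [])     m bs = refl
pathEdges-++ (a ∷ b ∷ as) m bs = cong ((a , b) ∷_) (pathEdges-++ (b ∷ as) m bs)

pathEdges-∈ : ∀ {A : Set} {e : A × A} as → e ∈ pathEdges as → proj₁ e ∈ as × proj₂ e ∈ as
pathEdges-∈ (a ∷ b ∷ as) (here refl) = here refl , there (here refl)
pathEdges-∈ (a ∷ b ∷ as) (there e∈)  = let p∈ , q∈ = pathEdges-∈ (b ∷ as) e∈ in there p∈ , there q∈

loopEdges-split : ∀ a as b bs →
  loopEdges (a ∷ as ++ b ∷ bs) ≡ pathEdges (a ∷ as ∷ʳ b) ++ pathEdges (b ∷ bs ∷ʳ a)
loopEdges-split a as b bs = begin
  loopEdges (a ∷ as ++ b ∷ bs)                        ≡⟨ zip≡pathEdges a (as ++ b ∷ bs) a ⟩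
  pathEdges (a ∷ (as ++ b ∷ bs) ∷ʳ a)                 ≡⟨ cong (pathEdges ∘ (a ∷_))
                                                               (++-assoc as (b ∷ bs) [ a ]) ⟩
  pathEdges ((a ∷ as) ++ b ∷ bs ∷ʳ a)                 ≡⟨ pathEdges-++ (a ∷ as) b (bs ∷ʳ a) ⟩
  pathEdges (a ∷ as ∷ʳ b) ++ pathEdges (b ∷ bs ∷ʳ a)  ∎
  where open ≡-Reasoning

loopEdges-rotate : ∀ as bs → loopEdges (as ++ bs) ↭ loopEdges (bs ++ as)
loopEdges-rotate []       bs       = ↭-reflexive (cong loopEdges (sym (++-identityʳ bs)))
loopEdges-rotate (a ∷ as) []       = ↭-reflexive (cong loopEdges (++-identityʳ (a ∷ as)))
loopEdges-rotate (a ∷ as) (b ∷ bs) = begin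
  loopEdges (a ∷ as ++ b ∷ bs)                        ≡⟨ loopEdges-split a as b bs ⟩
  pathEdges (a ∷ as ∷ʳ b) ++ pathEdges (b ∷ bs ∷ʳ a)  ↭⟨ ++-comm (pathEdges (a ∷ as ∷ʳ b)) _ ⟩
  pathEdges (b ∷ bs ∷ʳ a) ++ pathEdges (a ∷ as ∷ʳ b)  ≡⟨ loopEdges-split b bs a as ⟨
  loopEdges (b ∷ bs ++ a ∷ as)                        ∎
  where open ↭-Reasoning

record Passage {A : Set} (v : A) (E : List (A × A)) : Set where
  field
    prev next      : A
    others         : List (A × A)
    prev≢next      : prev ≢ next
    others-avoid-v : All (λ e → proj₁ e ≢ v × proj₂ e ≢ v) others
    edges↭         : E ↭ (prev , v) ∷ (v , next) ∷ others

Passage-resp-↭ : ∀ {A : Set} {v : A} {E E′} → E ↭ E′ → Passage v E′ → Passage v E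
Passage-resp-↭ E↭E′ P = record { Passage P hiding (edges↭) ; edges↭ = ↭-trans E↭E′ (Passage.edges↭ P) }

passage-head : ∀ v ps → Unique (v ∷ ps) → 3 ℕ.≤ length (v ∷ ps) → Passage v (loopEdges (v ∷ ps))
passage-head v (w ∷ ms) (v∉ ∷ w∉ ∷ _) (ℕ.s≤s (ℕ.s≤s 1≤∣ms∣)) with initLast ms
... | []         = contradiction 1≤∣ms∣ λ ()
... | rest ∷ʳ′ u = record
  { prev           = u
  ; next           = w
  ; others         = pathEdges ws
  ; prev≢next      = ≢-sym (All.lookup w∉ (∈-++⁺ʳ rest (here refl)))
  ; others-avoid-v = All.tabulate λ e∈ → let p∈ , q∈ = pathEdges-∈ ws e∈ in ∉⇒≢ p∈ , ∉⇒≢ q∈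
  ; edges↭         = edges
  }
  where
  ws = w ∷ rest ∷ʳ u
  ∉⇒≢ : ∀ {p} → p ∈ ws → p ≢ v
  ∉⇒≢ p∈ refl = All¬⇒¬Any v∉ p∈
  edges : loopEdges (v ∷ ws) ↭ (u , v) ∷ (v , w) ∷ pathEdges ws
  edges = begin
    loopEdges (v ∷ ws)                             ≡⟨ loopEdges-split v [] w (rest ∷ʳ u) ⟩
    (v , w) ∷ pathEdges (ws ∷ʳ v)                  ≡⟨ cong (λ l → (v , w) ∷ pathEdges l)
                                                           (++-assoc (w ∷ rest) [ u ] [ v ]) ⟩
    (v , w) ∷ pathEdges ((w ∷ rest) ++ u ∷ [ v ])  ≡⟨ cong ((v , w) ∷_) (pathEdges-++ (w ∷ rest) u [ v ]) ⟩
    (v , w) ∷ pathEdges ws ∷ʳ (u , v)              ↭⟨ ↭-prep (v , w)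
                                                           (↭-sym (∷↭∷ʳ (u , v) (pathEdges ws))) ⟩
    (v , w) ∷ (u , v) ∷ pathEdges ws               ↭⟨ ↭-swap (v , w) (u , v) ↭-refl ⟩
    (u , v) ∷ (v , w) ∷ pathEdges ws               ∎
    where open ↭-Reasoning

passage : ∀ {v vs} → Unique vs → 3 ℕ.≤ length vs → v ∈ vs → Passage v (loopEdges vs)
passage {v} uniq long v∈ with ∈-∃++ v∈
... | as , bs , refl = Passage-resp-↭ (loopEdges-rotate as (v ∷ bs))
  (passage-head v (bs ++ as) (Unique-resp-↭ (setoid Point) (↭⇒↭ₛ rotation) uniq)
                             (subst (3 ℕ.≤_) (↭-length rotation) long))
  where rotation = ++-comm as (v ∷ bs)

crosses-resp-ray : ∀ {a a′ b} e → let x₁ = proj₁ (proj₁ e) in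
  (double x₁ ≤ᵇ a) ≡ (double x₁ ≤ᵇ a′) → crosses (a , b) e ≡ crosses (a′ , b) e
crosses-resp-ray ((_ , _) , (_ , _)) eq rewrite eq = refl

∧-zeroʳ³ : ∀ p q r → p ∧ (q ∧ (r ∧ false)) ≡ false
∧-zeroʳ³ p q r rewrite ∧-zeroʳ r | ∧-zeroʳ q = ∧-zeroʳ p

crosses-horizontal : ∀ a b x₁ x₂ y → crosses (a , b) ((x₁ , y) , (x₂ , y)) ≡ false
crosses-horizontal a b x₁ x₂ y with double y ≤ᵇ b
... | true  = ∧-zeroʳ³ (double x₁ ≤ᵇ double x₂) (double x₂ ≤ᵇ double x₁) (a <ᵇ double x₁)
... | false = ∧-zeroʳ³ (double x₁ ≤ᵇ double x₂) (double x₂ ≤ᵇ double x₁) (a <ᵇ double x₁)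

crosses-↑ : ∀ a x y → crosses (a , double y) ((x , y) , (x , y + 1ℤ)) ≡ (a <ᵇ double x)
crosses-↑ a x y rewrite ≤ᵇ-true (≤-refl {double x}) | ≤ᵇ-true (≤-refl {double y})
  | ≤ᵇ-false (double-mono-< (i<i+1 y)) = ∧-identityʳ _

crosses-↓ : ∀ a x y → crosses (a , double y) ((x , y + 1ℤ) , (x , y)) ≡ (a <ᵇ double x)
crosses-↓ a x y rewrite ≤ᵇ-true (≤-refl {double x}) | ≤ᵇ-true (≤-refl {double y})
  | ≤ᵇ-false (double-mono-< (i<i+1 y)) = ∧-identityʳ _

crosses-↑-off : ∀ a x y₁ y → y₁ ≢ y → crosses (a , double y) ((x , y₁) , (x , y₁ + 1ℤ)) ≡ false
crosses-↑-off a x y₁ y y₁≢y with <-cmp y₁ y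
... | tri< y₁<y _ _
  rewrite ≤ᵇ-true (<⇒≤ (double-mono-< y₁<y)) | ≤ᵇ-true (double-mono-≤ (i<j⇒i+1≤j y₁<y))
  = ∧-zeroʳ³ (double x ≤ᵇ double x) (double x ≤ᵇ double x) (a <ᵇ double x)
... | tri≈ _ y₁≡y _ = contradiction y₁≡y y₁≢y
... | tri> _ _ y<y₁
  rewrite ≤ᵇ-false (double-mono-< y<y₁) | ≤ᵇ-false (double-mono-< (<-trans y<y₁ (i<i+1 y₁)))
  = ∧-zeroʳ³ (double x ≤ᵇ double x) (double x ≤ᵇ double x) (a <ᵇ double x)

crosses-↓-off : ∀ a x y₁ y → y₁ ≢ y → crosses (a , double y) ((x , y₁ + 1ℤ) , (x , y₁)) ≡ false
crosses-↓-off a x y₁ y y₁≢y with <-cmp y₁ y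
... | tri< y₁<y _ _
  rewrite ≤ᵇ-true (<⇒≤ (double-mono-< y₁<y)) | ≤ᵇ-true (double-mono-≤ (i<j⇒i+1≤j y₁<y))
  = ∧-zeroʳ³ (double x ≤ᵇ double x) (double x ≤ᵇ double x) (a <ᵇ double x)
... | tri≈ _ y₁≡y _ = contradiction y₁≡y y₁≢y
... | tri> _ _ y<y₁
  rewrite ≤ᵇ-false (double-mono-< y<y₁) | ≤ᵇ-false (double-mono-< (<-trans y<y₁ (i<i+1 y₁)))
  = ∧-zeroʳ³ (double x ≤ᵇ double x) (double x ≤ᵇ double x) (a <ᵇ double x)

crosses-off-row : ∀ {a x y₁ y q} → LatticeAdj (x , y₁) q → y₁ ≢ y → q ≢ (x , y) →
  crosses (a , double y) ((x , y₁) , q) ≡ false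
crosses-off-row {a} {x} {y₁} {y} {x₂ , _} (inj₁ (refl , _)) _ _ = crosses-horizontal a (double y) x x₂ y₁
crosses-off-row {a} {x} {y₁} {y} {_ , _} (inj₂ (refl , inj₁ refl)) y₁≢y _ = crosses-↑-off a x y₁ y y₁≢y
crosses-off-row {a} {x} {_} {y} {_ , y₂} (inj₂ (refl , inj₂ refl)) _ q≢v =
  crosses-↓-off a x y₂ y (q≢v ∘ cong (x ,_))

crosses-from-below : ∀ a x y → crosses (a , double y) ((x , y - 1ℤ) , (x , y)) ≡ false
crosses-from-below a x y = subst (λ y′ → crosses (a , double y) ((x , y - 1ℤ) , (x , y′)) ≡ false)
  (i-1+1≡i y) (crosses-↑-off a x (y - 1ℤ) y (<⇒≢ (i-1<i y)))

crosses-to-below : ∀ a x y → crosses (a , double y) ((x , y) , (x , y - 1ℤ)) ≡ false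
crosses-to-below a x y = subst (λ y′ → crosses (a , double y) ((x , y′) , (x , y - 1ℤ)) ≡ false)
  (i-1+1≡i y) (crosses-↓-off a x (y - 1ℤ) y (<⇒≢ (i-1<i y)))

-- In doubled coordinates, the midpoints of the horizontal edges at (x , y).
leftMid rightMid : Point → ℤ × ℤ
leftMid  (x , y) = (x + (x - 1ℤ) , double y)
rightMid (x , y) = (x + (x + 1ℤ) , double y)

ray-vertex : ∀ x x₁ → (double x₁ ≤ᵇ double x) ≡ (x₁ ≤ᵇ x)
ray-vertex x x₁ = ≤ᵇ-cong {double x₁} {double x} {x₁} {x}
  (mk⇔ (λ 2x₁≤2x → double-≤-double+1⇒≤ (≤-trans 2x₁≤2x (double≤double+1 x))) double-mono-≤)

ray-rightMid : ∀ x x₁ → (double x₁ ≤ᵇ x + (x + 1ℤ)) ≡ (x₁ ≤ᵇ x)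
ray-rightMid x x₁ = ≤ᵇ-cong {double x₁} {x + (x + 1ℤ)} {x₁} {x}
  (mk⇔ double-≤-double+1⇒≤ (λ x₁≤x → ≤-trans (double-mono-≤ x₁≤x) (double≤double+1 x)))

ray-leftMid : ∀ x x₁ → x₁ ≢ x → (double x₁ ≤ᵇ x + (x - 1ℤ)) ≡ (x₁ ≤ᵇ x)
ray-leftMid x x₁ x₁≢x = ≤ᵇ-cong {double x₁} {x + (x - 1ℤ)} {x₁} {x} (mk⇔
  (λ 2x₁≤2x-1 → double-≤-double+1⇒≤ (≤-trans 2x₁≤2x-1 (+-monoʳ-≤ x (<⇒≤ (<-trans (i-1<i x) (i<i+1 x))))))
  (λ x₁≤x → +-mono-≤ x₁≤x (i<j⇒i≤j-1 (≤∧≢⇒< x₁≤x x₁≢x))))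

crosses-vertex≡crosses-rightMid : ∀ x y e → crosses (double x , double y) e ≡ crosses (rightMid (x , y)) e
crosses-vertex≡crosses-rightMid x y e =
  crosses-resp-ray e (trans (ray-vertex x (proj₁ (proj₁ e))) (sym (ray-rightMid x (proj₁ (proj₁ e)))))

Balanced : Point → Point × Point → Set
Balanced v e = crosses (leftMid v) e ≡ crosses (rightMid v) e

Separates : Point → Point × Point → Set
Separates v e = crosses (leftMid v) e ≡ true × crosses (rightMid v) e ≡ false

balanced-avoiding : ∀ {v p q} → LatticeAdj p q → p ≢ v → q ≢ v → Balanced v (p , q)
balanced-avoiding {x , y} {x₁ , y₁} {q} adj p≢v q≢v with x₁ ≟ x
... | no x₁≢x  = crosses-resp-ray ((x₁ , y₁) , q) (trans (ray-leftMid x x₁ x₁≢x) (sym (ray-rightMid x x₁)))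
... | yes refl = trans (crosses-off-row adj y₁≢y q≢v) (sym (crosses-off-row adj y₁≢y q≢v))
  where
  y₁≢y : y₁ ≢ y
  y₁≢y = p≢v ∘ cong (x₁ ,_)

balanced-down : ∀ v → Balanced v (v , downOf v)
balanced-down (x , y) = trans (crosses-to-below _ x y) (sym (crosses-to-below _ x y))

balanced-down′ : ∀ v → Balanced v (downOf v , v)
balanced-down′ (x , y) = trans (crosses-from-below _ x y) (sym (crosses-from-below _ x y))

leftMid-west-of-column : ∀ x → ((x + (x - 1ℤ)) <ᵇ double x) ≡ true
leftMid-west-of-column x = cong not (≤ᵇ-false (+-monoʳ-< x (i-1<i x)))

rightMid-east-of-column : ∀ x → ((x + (x + 1ℤ)) <ᵇ double x) ≡ false
rightMid-east-of-column x = cong not (≤ᵇ-true (double≤double+1 x))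

separates-up : ∀ v → Separates v (v , upOf v)
separates-up (x , y) =
  trans (crosses-↑ _ x y) (leftMid-west-of-column x) , trans (crosses-↑ _ x y) (rightMid-east-of-column x)

separates-up′ : ∀ v → Separates v (upOf v , v)
separates-up′ (x , y) =
  trans (crosses-↓ _ x y) (leftMid-west-of-column x) , trans (crosses-↓ _ x y) (rightMid-east-of-column x)

crossCount≡length-filter : ∀ q es → crossCount q es ≡ length (filter (T? ∘ crosses q) es)
crossCount≡length-filter q []       = refl
crossCount≡length-filter q (e ∷ es) with crosses q e
... | true  = cong suc (crossCount≡length-filter q es)
... | false = crossCount≡length-filter q es

crossCount-↭ : ∀ q {es es′} → es ↭ es′ → crossCount q es ≡ crossCount q es′
crossCount-↭ q {es} {es′} es↭es′ = begin
  crossCount q es                       ≡⟨ crossCount≡length-filter q es ⟩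
  length (filter (T? ∘ crosses q) es)   ≡⟨ ↭-length (filter-↭ (T? ∘ crosses q) es↭es′) ⟩
  length (filter (T? ∘ crosses q) es′)  ≡⟨ crossCount≡length-filter q es′ ⟨
  crossCount q es′                      ∎
  where open ≡-Reasoning

crossCount-cong : ∀ {q q′} es → All (λ e → crosses q e ≡ crosses q′ e) es →
  crossCount q es ≡ crossCount q′ es
crossCount-cong []       []         = refl
crossCount-cong {q′ = q′} (e ∷ es) (eq ∷ eqs) rewrite eq with crosses q′ e
... | true  = cong suc (crossCount-cong es eqs)
... | false = crossCount-cong es eqs

crossCount-one-more : ∀ {q q′ e es es′} → es′ ↭ e ∷ es →
  crosses q e ≡ true × crosses q′ e ≡ false → All (λ f → crosses q f ≡ crosses q′ f) es →
  crossCount q es′ ≡ suc (crossCount q′ es′)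
crossCount-one-more {q} {q′} {es = es} es′↭e∷es (qe , q′e) eqs
  rewrite crossCount-↭ q es′↭e∷es | crossCount-↭ q′ es′↭e∷es | qe | q′e = cong suc (crossCount-cong es eqs)

-- suc (suc n) % 2 reduces to n % 2.
n%2≡1⊎[1+n]%2≡1 : ∀ n → n % 2 ≡ 1 ⊎ suc n % 2 ≡ 1
n%2≡1⊎[1+n]%2≡1 ℕ.zero  = inj₂ refl
n%2≡1⊎[1+n]%2≡1 (suc n) = swap (n%2≡1⊎[1+n]%2≡1 n)

module _ (α : SimpleLoop) where

  private
    E : List (Point × Point)
    E = loopEdges (verts α)

  interior-vertex⇒interior-rightMid : ∀ x y →
    InInteriorD α (double x , double y) → InInteriorD α (rightMid (x , y))
  interior-vertex⇒interior-rightMid x y =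
    subst (λ n → n % 2 ≡ 1) (crossCount-cong E (All.universal (crosses-vertex≡crosses-rightMid x y) E))

  one-midpoint-inside : ∀ x y → crossCount (leftMid (x , y)) E ≡ suc (crossCount (rightMid (x , y)) E) →
    GEdge α (x , y) (leftOf (x , y)) ⊎ GEdge α (x , y) (rightOf (x , y))
  one-midpoint-inside x y left≡1+right with n%2≡1⊎[1+n]%2≡1 (crossCount (rightMid (x , y)) E)
  ... | inj₁ right-odd = inj₂ (adjacent-right (x , y) , inj₂ (inj₂ right-odd))
  ... | inj₂ left-odd  =
    inj₁ (adjacent-left (x , y) , inj₂ (inj₂ (subst (λ n → n % 2 ≡ 1) (sym left≡1+right) left-odd)))

  by-neighbours : ∀ {x y u w M} → Neighbour (x , y) u → Neighbour (x , y) w → u ≢ w →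
    E ↭ (u , (x , y)) ∷ ((x , y) , w) ∷ M → All (Balanced (x , y)) M →
    GEdge α (x , y) (leftOf (x , y)) ⊎ GEdge α (x , y) (rightOf (x , y))
  by-neighbours left  _     _   E↭ _ = inj₁ (adjacent-left _  , inj₂ (inj₁ (∈-resp-↭ (↭-sym E↭) (here refl))))
  by-neighbours right _     _   E↭ _ = inj₂ (adjacent-right _ , inj₂ (inj₁ (∈-resp-↭ (↭-sym E↭) (here refl))))
  by-neighbours _     left  _   E↭ _ = inj₁ (adjacent-left _  , inj₁ (∈-resp-↭ (↭-sym E↭) (there (here refl))))
  by-neighbours _     right _   E↭ _ = inj₂ (adjacent-right _ , inj₁ (∈-resp-↭ (↭-sym E↭) (there (here refl))))
  by-neighbours up    up    u≢w _  _ = contradiction refl u≢w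
  by-neighbours down  down  u≢w _  _ = contradiction refl u≢w
  by-neighbours {x} {y} up down _ E↭ M-balanced =
    one-midpoint-inside x y (crossCount-one-more E↭ (separates-up′ (x , y)) (balanced-down (x , y) ∷ M-balanced))
  by-neighbours {x} {y} down up _ E↭ M-balanced =
    one-midpoint-inside x y (crossCount-one-more (↭-trans E↭ (↭-swap _ _ ↭-refl)) (separates-up (x , y))
                                                 (balanced-down′ (x , y) ∷ M-balanced))

  on-loop : ∀ x y → (x , y) ∈ verts α → GEdge α (x , y) (leftOf (x , y)) ⊎ GEdge α (x , y) (rightOf (x , y))
  on-loop x y v∈α = by-neighbours (neighbour (LatticeAdj-sym (All.head adj))) (neighbour (All.head (All.tail adj)))
                                  prev≢next edges↭ others-balanced
    where
    open Passage (passage (distinct α) (long α) v∈α)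
    adj : All (λ e → LatticeAdj (proj₁ e) (proj₂ e)) ((prev , (x , y)) ∷ ((x , y) , next) ∷ others)
    adj = All-resp-↭ edges↭ (steps α)
    others-balanced : All (Balanced (x , y)) others
    others-balanced = All.zipWith (λ (step , p≢v , q≢v) → balanced-avoiding step p≢v q≢v)
                                  (All.tail (All.tail adj) , others-avoid-v)

lemma4p3 : (α : SimpleLoop) (v : Point) → GVertex α v →
    GEdge α v (leftOf v) ⊎ GEdge α v (rightOf v)
lemma4p3 α (x , y) (inj₁ v∈α)      = on-loop α x y v∈α
lemma4p3 α (x , y) (inj₂ v-inside) =
  inj₂ (adjacent-right (x , y) , inj₂ (inj₂ (interior-vertex⇒interior-rightMid α x y v-inside)))
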